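{- $(\mathcal B)_+$ is generated as a bigraft algebra by $\bullet_1$: the smallest subspace of $(\mathcal B)_+$ containing $\bullet_1$ and stable under concatenation, $\succ$ and $\prec$ is $(\mathcal B)_+$ itself.
   Context: An ordered forest of degree $n\ge0$ is a planar rooted forest (left-to-right sequence of rooted trees, children of each vertex linearly ordered left to right) with $n$ vertices together with a bijection from its vertex set to $\{1,\dots,n\}$ (labels); edges point towards roots; $\bullet_1$ is the one-vertex tree, $|F|$ the degree. The product $FG$ is concatenation, labels of $F$ kept, labels of $G$ increased by $|F|$. For nonempty ordered trees $T_1,\dots,T_m$ of total degree $n$: $B^-(T_1,\dots,T_m)$ is the forest $T_1\cdots T_m$ with a new root labelled $n+1$ whose children are the roots of $T_1,\dots,T_m$ in order; $B^+(T_1,\dots,T_m)$ is $T_1\cdots T_m$ with a new vertex labelled $n+1$ added as the rightmost child of the root of $T_1$, the roots of $T_2,\dots,T_m$ becoming (in order) its children. $\mathcal T$ is the smallest set of ordered trees containing $\bullet_1$ and closed under $B^\pm$ applied to finite nonempty sequences of its elements. $(\mathcal B)_+$ is the span of the nonempty forests all of whose trees lie in $\mathcal T$. Left graft $\succ$: for nonempty trees $T,G$, $T\succ G$ grafts $T$ on the root of $G$ as its leftmost child, labels of $T$ kept and those of $G$ increased by $|T|$; $(T_1\cdots T_n)\succ G=T_1\succ(T_2\succ(\cdots(T_n\succ G)\cdots))$ for a tree $G$; $(T_1\cdots T_n)\succ(G_1\cdots G_m)=((T_1\cdots T_n)\succ G_1)G_2\cdots G_m$. Right graft $\prec$: for nonempty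 trees $T,G$, $T\prec G$ grafts $G$ on the root of $T$ as its rightmost child; labels of $T$ kept, non-root vertices of $G$ labelled $|T|+1,\dots$ in their original relative order, the root of $G$ labelled $|T|+|G|$; $T\prec(G_1\cdots G_m)=(\cdots((T\prec G_1)\prec G_2)\cdots)\prec G_m$; $(T_1\cdots T_n)\prec(G_1\cdots G_m)=T_1\cdots T_{n-1}(T_n\prec(G_1\cdots G_m))$. Both operations are extended bilinearly; $(\mathcal B)_+$ is stable under concatenation, $\succ$ and $\prec$. -}

module Defs where

open import Level using (Level; _⊔_)
open import Data.Nat using (ℕ; zero; suc; _+_; _∸_; _<ᵇ_)
import Data.Nat as ℕ
open import Data.Bool using (Bool; true; false; if_then_else_; _∧_)
open import Data.List using (List; []; _∷_; _++_; [_]; map; concatMap; foldr)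
open import Data.List.Relation.Unary.All using (All)
open import Data.Product using (Σ; _×_; _,_; ∃)
open import Relation.Binary.PropositionalEquality using (_≡_; _≢_)
open import Relation.Nullary.Decidable using (does)
open import Algebra.Apartness.Bundles using (HeytingField)

-- Ordered (planar, labelled) trees.
-- node ℓ cs : a vertex with label ℓ whose children (left to right) are
-- the roots of the trees cs.  An ordered tree of degree n is such a
-- tree whose n labels form a bijection onto {1,…,n}; all trees produced
-- below (•₁, B⁻, B⁺, grafts, products) have this property.

data Tree : Set where
  node : ℕ → List Tree → Tree

-- An ordered forest which is a concatenation product T₁⋯Tₖ of ordered
-- trees is represented by the list [T₁,…,Tₖ] of the (standardised)
-- trees; the actual labels of Tᵢ inside the forest are shifted by
-- |T₁|+⋯+|Tᵢ₋₁|.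
Forest : Set
Forest = List Tree

mutual
  size : Tree → ℕ
  size (node _ cs) = suc (sizeF cs)

  sizeF : Forest → ℕ
  sizeF [] = 0
  sizeF (t ∷ ts) = size t + sizeF ts

mutual
  relabel : (ℕ → ℕ) → Tree → Tree
  relabel f (node l cs) = node (f l) (relabelF f cs)

  relabelF : (ℕ → ℕ) → Forest → Forest
  relabelF f [] = []
  relabelF f (t ∷ ts) = relabel f t ∷ relabelF f ts

shift : ℕ → Tree → Tree
shift k = relabel (λ l → l + k)

shiftF : ℕ → Forest → Forest
shiftF k = relabelF (λ l → l + k)

placeFrom : ℕ → Forest → Forest
placeFrom k [] = []
placeFrom k (t ∷ ts) = shift k t ∷ placeFrom (k + size t) ts

place : Forest → Forest
place = placeFrom 0

•₁ : Tree
•₁ = node 1 []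

B⁻ : Tree → List Tree → Tree
B⁻ T Ts = node (suc (sizeF (T ∷ Ts))) (place (T ∷ Ts))

B⁺ : Tree → List Tree → Tree
B⁺ (node r cs) Ts =
  node r (cs ++ [ node (suc (sizeF (node r cs ∷ Ts)))
                       (placeFrom (size (node r cs)) Ts) ])

data 𝒯 : Tree → Set where
  𝒯• : 𝒯 •₁
  𝒯⁻ : ∀ {T Ts} → 𝒯 T → All 𝒯 Ts → 𝒯 (B⁻ T Ts)
  𝒯⁺ : ∀ {T Ts} → 𝒯 T → All 𝒯 Ts → 𝒯 (B⁺ T Ts)

data ℬ₊Forest : Forest → Set where
  nonempty : ∀ {T Ts} → 𝒯 T → All 𝒯 Ts → ℬ₊Forest (T ∷ Ts)

-- concatenation product (labels of the second factor implicitly shifted)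
_·_ : Forest → Forest → Forest
F · G = F ++ G

_≻ₜ_ : Tree → Tree → Tree
T ≻ₜ node r cs = node (r + size T) (T ∷ shiftF (size T) cs)

_≻ₜₛ_ : Forest → Tree → Tree
[] ≻ₜₛ G = G
(T ∷ Ts) ≻ₜₛ G = T ≻ₜ (Ts ≻ₜₛ G)

_≻_ : Forest → Forest → Forest
F ≻ [] = F            -- not used (only nonempty forests occur)
F ≻ (G ∷ Gs) = (F ≻ₜₛ G) ∷ Gs

-- right graft of a tree on a tree: non-root labels of G become
-- |T|+1,… in their relative order, the root of G gets |T|+|G|
_≺ₜ_ : Tree → Tree → Tree
node r cs ≺ₜ node g ds =
  node r (cs ++ [ relabel f (node g ds) ])
  where
    t = size (node r cs)
    f : ℕ → ℕ
    f l = if does (l ℕ.≟ g) then t + size (node g ds)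
          else (if l <ᵇ g then t + l else t + (l ∸ 1))

_≺ₜₛ_ : Tree → Forest → Tree
T ≺ₜₛ [] = T
T ≺ₜₛ (G ∷ Gs) = (T ≺ₜ G) ≺ₜₛ Gs

_≺_ : Forest → Forest → Forest
[] ≺ G = G             -- not used (only nonempty forests occur)
(T ∷ []) ≺ G = (T ≺ₜₛ G) ∷ []
(T ∷ T′ ∷ Ts) ≺ G = T ∷ ((T′ ∷ Ts) ≺ G)

mutual
  _==_ : Tree → Tree → Bool
  node a cs == node b ds = does (a ℕ.≟ b) ∧ (cs ==F ds)

  _==F_ : Forest → Forest → Bool
  [] ==F [] = true
  (t ∷ ts) ==F (u ∷ us) = (t == u) ∧ (ts ==F us)
  _ ==F _ = false

-- The vector space spanned by ordered forests, over a field K.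
-- A vector is a finite formal linear combination of forests; two
-- vectors are equal when all their coefficients agree.

module Lin {c ℓ₁ ℓ₂ : Level} (K : HeytingField c ℓ₁ ℓ₂) where
  open HeytingField K renaming (Carrier to k; _+_ to _+ₖ_; _*_ to _*ₖ_)

  V : Set c
  V = List (k × Forest)

  coeff : V → Forest → k
  coeff [] F = 0#
  coeff ((a , G) ∷ v) F = (if G ==F F then a else 0#) +ₖ coeff v F

  _≈ᵥ_ : V → V → Set ℓ₁
  u ≈ᵥ v = ∀ F → coeff u F ≈ coeff v F

  _+ᵥ_ : V → V → V
  u +ᵥ v = u ++ v

  _∙ᵥ_ : k → V → V
  a ∙ᵥ v = map (λ { (b , F) → (a *ₖ b , F) }) v

  bilin : (Forest → Forest → Forest) → V → V → V
  bilin op u v =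
    concatMap (λ { (a , F) → map (λ { (b , G) → (a *ₖ b , op F G) }) v }) u

  basis : Forest → V
  basis F = [ (1# , F) ]

  Inℬ₊ : V → Set (c ⊔ ℓ₁)
  Inℬ₊ v = Σ V λ w → (v ≈ᵥ w) × All (λ { (a , F) → ℬ₊Forest F }) w

  -- the smallest subspace containing •₁ and stable under concatenation,
  -- ≻ and ≺ (inductively generated, hence the least such subspace)
  data Gen : V → Set (c ⊔ ℓ₁) where
    gen•   : Gen (basis [ •₁ ])
    gen0   : Gen []
    gen+   : ∀ {u v} → Gen u → Gen v → Gen (u +ᵥ v)
    gen∙   : ∀ {u} a → Gen u → Gen (a ∙ᵥ u)
    gen≈   : ∀ {u v} → u ≈ᵥ v → Gen u → Gen v
    gen·   : ∀ {u v} → Gen u → Gen v → Gen (bilin _·_ u v)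
    gen≻   : ∀ {u v} → Gen u → Gen v → Gen (bilin _≻_ u v)
    gen≺   : ∀ {u v} → Gen u → Gen v → Gen (bilin _≺_ u v)

module Submission where

-- Every tree of 𝒯 is obtained from •₁ by the two grafts: B⁻(T₁,…,Tₘ) = (T₁⋯Tₘ) ≻ •₁ and
-- B⁺(T,T₁,…,Tₘ) = T ≺ B⁻(T₁,…,Tₘ) (reading B⁻ of the empty sequence as •₁), and a basis
-- forest of (ℬ)₊ is a product of such trees; so every basis forest is generated.
-- Conversely 𝒯 is stable under both grafts: T ≻ B⁻(G₁,…,Gₘ) = B⁻(T,G₁,…,Gₘ),
-- T ≻ B⁺(G,H₁,…) = B⁺(T ≻ G,H₁,…), and T ≺ G = B⁺(T,D₁,…,Dₖ) where D₁⋯Dₖ is G with its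
-- root deleted, which again consists of trees of 𝒯 (by induction on G, using that the
-- root of a tree of 𝒯 carries a smaller label than every vertex added by a B⁺).
-- Since the vector operations are bilinear extensions, and these respect equality of
-- coefficients (a coefficient of the extension is a finite sum over the joint support),
-- stability on basis forests gives stability of the span.

open import Defs
open import Data.Product using (_×_; _,_)
open import Algebra.Apartness.Bundles using (HeytingField)

module Trees where
  open import Data.Nat using (ℕ; suc; _+_; _∸_; _<ᵇ_; _≤_; _<_; z≤n; s≤s)
  import Data.Nat as ℕ
  open import Data.Nat.Properties
  open import Algebra.Properties.CommutativeSemigroup +-commutativeSemigroup using (xy∙z≈xz∙y)
  open import Data.Bool using (true; false; if_then_else_)
  open import Data.List using (List; []; _∷_; _++_; [_])
  open import Data.List.Relation.Unary.All using (All; []; _∷_)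
  open import Data.List.Relation.Unary.All.Properties using (++⁺)
  open import Data.Product using (Σ-syntax; _,_; proj₁; proj₂)
  open import Data.Unit using (⊤; tt)
  open import Function.Bundles using (Equivalence)
  open import Relation.Binary.Definitions using (DecidableEquality)
  open import Relation.Binary.PropositionalEquality hiding ([_])
  open import Relation.Nullary using (contradiction)
  open import Relation.Nullary.Decidable using (does; _because_; dec-true; dec-false)
  open import Relation.Nullary.Reflects using (Reflects; ofʸ; ofⁿ; fromEquivalence)
  open import Data.Bool.Properties using (T-≡)

  mutual
    AllLabels : (ℕ → Set) → Tree → Set
    AllLabels P (node l cs) = P l × AllLabelsF P cs

    AllLabelsF : (ℕ → Set) → Forest → Set
    AllLabelsF P [] = ⊤
    AllLabelsF P (t ∷ ts) = AllLabels P t × AllLabelsF P ts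

  mutual
    AllLabels-map : ∀ {P Q : ℕ → Set} → (∀ {l} → P l → Q l) → ∀ t → AllLabels P t → AllLabels Q t
    AllLabels-map f (node l cs) (p , ps) = f p , AllLabelsF-map f cs ps

    AllLabelsF-map : ∀ {P Q : ℕ → Set} → (∀ {l} → P l → Q l) → ∀ ts → AllLabelsF P ts → AllLabelsF Q ts
    AllLabelsF-map f [] _ = tt
    AllLabelsF-map f (t ∷ ts) (p , ps) = AllLabels-map f t p , AllLabelsF-map f ts ps

  mutual
    AllLabels-universal : ∀ {P : ℕ → Set} → (∀ l → P l) → ∀ t → AllLabels P t
    AllLabels-universal f (node l cs) = f l , AllLabelsF-universal f cs

    AllLabelsF-universal : ∀ {P : ℕ → Set} → (∀ l → P l) → ∀ ts → AllLabelsF P ts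
    AllLabelsF-universal f [] = tt
    AllLabelsF-universal f (t ∷ ts) = AllLabels-universal f t , AllLabelsF-universal f ts

  mutual
    AllLabels-relabel : ∀ {P : ℕ → Set} f t → AllLabels (λ l → P (f l)) t → AllLabels P (relabel f t)
    AllLabels-relabel f (node l cs) (p , ps) = p , AllLabelsF-relabel f cs ps

    AllLabelsF-relabel : ∀ {P : ℕ → Set} f ts → AllLabelsF (λ l → P (f l)) ts → AllLabelsF P (relabelF f ts)
    AllLabelsF-relabel f [] _ = tt
    AllLabelsF-relabel f (t ∷ ts) (p , ps) = AllLabels-relabel f t p , AllLabelsF-relabel f ts ps

  AllLabelsF-++ : ∀ {P : ℕ → Set} xs ys → AllLabelsF P xs → AllLabelsF P ys → AllLabelsF P (xs ++ ys)
  AllLabelsF-++ [] ys _ q = q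
  AllLabelsF-++ (x ∷ xs) ys (p , ps) q = p , AllLabelsF-++ xs ys ps q

  mutual
    relabel-cong : ∀ f g t → AllLabels (λ l → f l ≡ g l) t → relabel f t ≡ relabel g t
    relabel-cong f g (node l cs) (p , ps) = cong₂ node p (relabelF-cong f g cs ps)

    relabelF-cong : ∀ f g ts → AllLabelsF (λ l → f l ≡ g l) ts → relabelF f ts ≡ relabelF g ts
    relabelF-cong f g [] _ = refl
    relabelF-cong f g (t ∷ ts) (p , ps) = cong₂ _∷_ (relabel-cong f g t p) (relabelF-cong f g ts ps)

  relabelF-cong′ : ∀ {f g} → (∀ l → f l ≡ g l) → ∀ ts → relabelF f ts ≡ relabelF g ts
  relabelF-cong′ {f} {g} f≗g ts = relabelF-cong f g ts (AllLabelsF-universal f≗g ts)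

  mutual
    relabel-∘ : ∀ f g t → relabel f (relabel g t) ≡ relabel (λ l → f (g l)) t
    relabel-∘ f g (node l cs) = cong (node (f (g l))) (relabelF-∘ f g cs)

    relabelF-∘ : ∀ f g ts → relabelF f (relabelF g ts) ≡ relabelF (λ l → f (g l)) ts
    relabelF-∘ f g [] = refl
    relabelF-∘ f g (t ∷ ts) = cong₂ _∷_ (relabel-∘ f g t) (relabelF-∘ f g ts)

  mutual
    relabel-id : ∀ t → relabel (λ l → l) t ≡ t
    relabel-id (node l cs) = cong (node l) (relabelF-id cs)

    relabelF-id : ∀ ts → relabelF (λ l → l) ts ≡ ts
    relabelF-id [] = refl
    relabelF-id (t ∷ ts) = cong₂ _∷_ (relabel-id t) (relabelF-id ts)

  relabelF-++ : ∀ f xs ys → relabelF f (xs ++ ys) ≡ relabelF f xs ++ relabelF f ys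
  relabelF-++ f [] ys = refl
  relabelF-++ f (x ∷ xs) ys = cong (relabel f x ∷_) (relabelF-++ f xs ys)

  shift-zero : ∀ t → shift 0 t ≡ t
  shift-zero t = trans (relabel-cong _ _ t (AllLabels-universal +-identityʳ t)) (relabel-id t)

  mutual
    size-relabel : ∀ f t → size (relabel f t) ≡ size t
    size-relabel f (node l cs) = cong suc (sizeF-relabel f cs)

    sizeF-relabel : ∀ f ts → sizeF (relabelF f ts) ≡ sizeF ts
    sizeF-relabel f [] = refl
    sizeF-relabel f (t ∷ ts) = cong₂ _+_ (size-relabel f t) (sizeF-relabel f ts)

  sizeF-++ : ∀ xs ys → sizeF (xs ++ ys) ≡ sizeF xs + sizeF ys
  sizeF-++ [] ys = refl
  sizeF-++ (x ∷ xs) ys = trans (cong (size x +_) (sizeF-++ xs ys)) (sym (+-assoc (size x) _ _))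

  sizeF-placeFrom : ∀ k ts → sizeF (placeFrom k ts) ≡ sizeF ts
  sizeF-placeFrom k [] = refl
  sizeF-placeFrom k (t ∷ ts) = cong₂ _+_ (size-relabel _ t) (sizeF-placeFrom (k + size t) ts)

  placeFrom-++ : ∀ k xs ys → placeFrom k (xs ++ ys) ≡ placeFrom k xs ++ placeFrom (k + sizeF xs) ys
  placeFrom-++ k [] ys = cong (λ m → placeFrom m ys) (sym (+-identityʳ k))
  placeFrom-++ k (x ∷ xs) ys = cong (shift k x ∷_) (trans (placeFrom-++ (k + size x) xs ys)
    (cong (λ m → placeFrom (k + size x) xs ++ placeFrom m ys) (+-assoc k (size x) (sizeF xs))))

  placeFrom-+ : ∀ m k ts → placeFrom (m + k) ts ≡ shiftF k (placeFrom m ts)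
  placeFrom-+ m k [] = refl
  placeFrom-+ m k (t ∷ ts) = cong₂ _∷_
    (sym (trans (relabel-∘ (_+ k) (_+ m) t) (relabel-cong _ _ t (AllLabels-universal (λ l → +-assoc l m k) t))))
    (trans (cong (λ x → placeFrom x ts) (xy∙z≈xz∙y m k (size t))) (placeFrom-+ (m + size t) k ts))

  placeFrom≡shiftF-place : ∀ k ts → placeFrom k ts ≡ shiftF k (place ts)
  placeFrom≡shiftF-place = placeFrom-+ 0

  InRange : ℕ → ℕ → ℕ → Set
  InRange k n l = k < l × l ≤ k + n

  InRange-widen : ∀ {k n k′ n′ l} → k′ ≤ k → k + n ≤ k′ + n′ → InRange k n l → InRange k′ n′ l
  InRange-widen k′≤k end≤end (k<l , l≤end) = ≤-trans (s≤s k′≤k) k<l , ≤-trans l≤end end≤end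

  WellLabelled : Tree → Set
  WellLabelled t = AllLabels (InRange 0 (size t)) t

  shift-InRange : ∀ k n t → AllLabels (InRange 0 n) t → AllLabels (InRange k n) (shift k t)
  shift-InRange k n t inRange = AllLabels-relabel (_+ k) t (AllLabels-map
    (λ {l} (0<l , l≤n) → +-monoˡ-≤ k 0<l , subst (l + k ≤_) (+-comm n k) (+-monoˡ-≤ k l≤n)) t inRange)

  placeFrom-InRange : ∀ k ts → All WellLabelled ts → AllLabelsF (InRange k (sizeF ts)) (placeFrom k ts)
  placeFrom-InRange k [] [] = tt
  placeFrom-InRange k (t ∷ ts) (std ∷ stds) =
    AllLabels-map (InRange-widen ≤-refl (+-monoʳ-≤ k (m≤m+n (size t) (sizeF ts)))) (shift k t)
      (shift-InRange k (size t) t std) ,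
    AllLabelsF-map (InRange-widen (m≤m+n k (size t)) (≤-reflexive (+-assoc k (size t) (sizeF ts))))
      (placeFrom (k + size t) ts) (placeFrom-InRange (k + size t) ts stds)

  size-B⁻ : ∀ T Ts → size (B⁻ T Ts) ≡ suc (sizeF (T ∷ Ts))
  size-B⁻ T Ts = cong suc (sizeF-placeFrom 0 (T ∷ Ts))

  size-B⁺ : ∀ T Ts → size (B⁺ T Ts) ≡ suc (sizeF (T ∷ Ts))
  size-B⁺ (node r cs) Ts = cong suc (begin
      sizeF (cs ++ [ X ])                     ≡⟨ sizeF-++ cs [ X ] ⟩
      sizeF cs + (size X + 0)                 ≡⟨ cong (sizeF cs +_) (+-identityʳ (size X)) ⟩
      sizeF cs + suc (sizeF (placeFrom s Ts)) ≡⟨ cong (λ z → sizeF cs + suc z) (sizeF-placeFrom s Ts) ⟩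
      sizeF cs + suc (sizeF Ts)               ≡⟨ +-suc (sizeF cs) (sizeF Ts) ⟩
      suc (sizeF cs + sizeF Ts)               ∎)
    where
      open ≡-Reasoning
      s = size (node r cs)
      X = node (suc (sizeF (node r cs ∷ Ts))) (placeFrom s Ts)

  mutual
    𝒯⇒WellLabelled : ∀ {t} → 𝒯 t → WellLabelled t
    𝒯⇒WellLabelled 𝒯• = (s≤s z≤n , ≤-refl) , tt
    𝒯⇒WellLabelled (𝒯⁻ {T} {Ts} 𝒯T 𝒯Ts) rewrite size-B⁻ T Ts =
      (s≤s z≤n , ≤-refl) ,
      AllLabelsF-map (InRange-widen ≤-refl (n≤1+n _)) (place (T ∷ Ts))
        (placeFrom-InRange 0 (T ∷ Ts) (𝒯⇒WellLabelled 𝒯T ∷ All𝒯⇒WellLabelled 𝒯Ts))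
    𝒯⇒WellLabelled (𝒯⁺ {node r cs} {Ts} 𝒯T 𝒯Ts) rewrite size-B⁺ (node r cs) Ts
      with (r-inRange , cs-inRange) ← 𝒯⇒WellLabelled 𝒯T =
      InRange-widen ≤-refl s≤n r-inRange ,
      AllLabelsF-++ cs _ (AllLabelsF-map (InRange-widen ≤-refl s≤n) cs cs-inRange)
        (((s≤s z≤n , ≤-refl) ,
          AllLabelsF-map (InRange-widen z≤n (n≤1+n _)) (placeFrom s Ts)
            (placeFrom-InRange s Ts (All𝒯⇒WellLabelled 𝒯Ts))) ,
         tt)
      where
        s = size (node r cs)
        s≤n : s ≤ suc (sizeF (node r cs ∷ Ts))
        s≤n = ≤-trans (m≤m+n s (sizeF Ts)) (n≤1+n _)

    All𝒯⇒WellLabelled : ∀ {ts} → All 𝒯 ts → All WellLabelled ts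
    All𝒯⇒WellLabelled [] = []
    All𝒯⇒WellLabelled (𝒯t ∷ 𝒯ts) = 𝒯⇒WellLabelled 𝒯t ∷ All𝒯⇒WellLabelled 𝒯ts

  -- B⁻ extended to the empty sequence: B⁻ T Ts = B⁻* (T ∷ Ts) and B⁻* [] = •₁.
  B⁻* : Forest → Tree
  B⁻* Ts = node (suc (sizeF Ts)) (place Ts)

  B⁻*-𝒯 : ∀ {Ts} → All 𝒯 Ts → 𝒯 (B⁻* Ts)
  B⁻*-𝒯 [] = 𝒯•
  B⁻*-𝒯 (𝒯T ∷ 𝒯Ts) = 𝒯⁻ 𝒯T 𝒯Ts

  ≻ₜ-B⁻* : ∀ T Gs → T ≻ₜ B⁻* Gs ≡ B⁻* (T ∷ Gs)
  ≻ₜ-B⁻* T Gs = cong₂ node (cong suc (+-comm (sizeF Gs) (size T)))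
    (cong₂ _∷_ (sym (shift-zero T)) (sym (placeFrom≡shiftF-place (size T) Gs)))

  size-≻ₜ : ∀ T G → size (T ≻ₜ G) ≡ size G + size T
  size-≻ₜ T (node r cs) = cong suc (trans (cong (size T +_) (sizeF-relabel _ cs)) (+-comm (size T) (sizeF cs)))

  ≻ₜ-B⁺ : ∀ T G Hs → T ≻ₜ B⁺ G Hs ≡ B⁺ (T ≻ₜ G) Hs
  ≻ₜ-B⁺ T (node r cs) Hs = cong (node (r + t)) (cong (T ∷_) (trans
      (relabelF-++ (_+ t) cs [ X ])
      (cong (shiftF t cs ++_) (cong [_] (begin
        node (suc (s + h) + t) (shiftF t (placeFrom s Hs))
          ≡⟨ cong₂ node (cong suc (xy∙z≈xz∙y s h t)) (sym (placeFrom-+ s t Hs)) ⟩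
        node (suc (s + t + h)) (placeFrom (s + t) Hs)
          ≡⟨ cong (λ z → node (suc (z + h)) (placeFrom z Hs)) (sym (size-≻ₜ T (node r cs))) ⟩
        node (suc (size (T ≻ₜ node r cs) + h)) (placeFrom (size (T ≻ₜ node r cs)) Hs) ∎)))))
    where
      open ≡-Reasoning
      t = size T
      s = size (node r cs)
      h = sizeF Hs
      X = node (suc (sizeF (node r cs ∷ Hs))) (placeFrom s Hs)

  ≻ₜ-𝒯 : ∀ {T G} → 𝒯 T → 𝒯 G → 𝒯 (T ≻ₜ G)
  ≻ₜ-𝒯 {T} 𝒯T 𝒯• = subst 𝒯 (sym (≻ₜ-B⁻* T [])) (𝒯⁻ 𝒯T [])
  ≻ₜ-𝒯 {T} 𝒯T (𝒯⁻ {G} {Gs} 𝒯G 𝒯Gs) = subst 𝒯 (sym (≻ₜ-B⁻* T (G ∷ Gs))) (𝒯⁻ 𝒯T (𝒯G ∷ 𝒯Gs))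
  ≻ₜ-𝒯 {T} 𝒯T (𝒯⁺ {G} {Hs} 𝒯G 𝒯Hs) = subst 𝒯 (sym (≻ₜ-B⁺ T G Hs)) (𝒯⁺ (≻ₜ-𝒯 𝒯T 𝒯G) 𝒯Hs)

  ≻ₜₛ-𝒯 : ∀ {Ts G} → All 𝒯 Ts → 𝒯 G → 𝒯 (Ts ≻ₜₛ G)
  ≻ₜₛ-𝒯 [] 𝒯G = 𝒯G
  ≻ₜₛ-𝒯 (𝒯T ∷ 𝒯Ts) 𝒯G = ≻ₜ-𝒯 𝒯T (≻ₜₛ-𝒯 𝒯Ts 𝒯G)

  ≻ₜₛ-•₁ : ∀ Ts → Ts ≻ₜₛ •₁ ≡ B⁻* Ts
  ≻ₜₛ-•₁ [] = refl
  ≻ₜₛ-•₁ (T ∷ Ts) = trans (cong (T ≻ₜ_) (≻ₜₛ-•₁ Ts)) (≻ₜ-B⁻* T Ts)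

  -- The relabelling of G in T ≺ₜ G for t = |T| and g the root label of G, which
  -- sends g to M = |T| + |G|.  M is left free: deleting the root of B⁺ G Hs
  -- reduces to deleting the root of G, which has the same root label but another size.
  graftLabel : ℕ → ℕ → ℕ → ℕ → ℕ
  graftLabel t g M l = if does (l ℕ.≟ g) then M else (if l <ᵇ g then t + l else t + (l ∸ 1))

  graftLabel-≡ : ∀ t g M → graftLabel t g M g ≡ M
  graftLabel-≡ t g M rewrite dec-true (g ℕ.≟ g) refl = refl

  graftLabel-< : ∀ t g M {l} → l < g → graftLabel t g M l ≡ t + l
  graftLabel-< t g M {l} l<g
    rewrite dec-false (l ℕ.≟ g) (<⇒≢ l<g) | Equivalence.to T-≡ (<⇒<ᵇ l<g) = refl

  graftLabel-> : ∀ t g M {l} → g < l → graftLabel t g M l ≡ t + (l ∸ 1)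
  graftLabel-> t g M {l} g<l rewrite dec-false (l ℕ.≟ g) (>⇒≢ g<l) with l <ᵇ g | <ᵇ-reflects-< l g
  ... | false | _ = refl
  ... | true | ofʸ l<g = contradiction g<l (<⇒≯ l<g)

  children : Tree → Forest
  children (node _ ds) = ds

  root : Tree → ℕ
  root (node g _) = g

  ≺ₜ-B⁺ : ∀ T G Ds →
          relabelF (graftLabel (size T) (root G) (size T + size G)) (children G) ≡ shiftF (size T) (place Ds) →
          T ≺ₜ G ≡ B⁺ T Ds
  ≺ₜ-B⁺ (node r cs) (node g ds) Ds eq = cong (node r) (cong (cs ++_) (cong [_] (cong₂ node
      (trans (graftLabel-≡ t g M) (trans (+-suc t (sizeF ds)) (cong (λ z → suc (t + z)) sizes-agree)))
      (trans eq (sym (placeFrom≡shiftF-place t Ds))))))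
    where
      t = size (node r cs)
      M = t + size (node g ds)
      sizes-agree : sizeF ds ≡ sizeF Ds
      sizes-agree = begin
        sizeF ds                               ≡⟨ sym (sizeF-relabel (graftLabel t g M) ds) ⟩
        sizeF (relabelF (graftLabel t g M) ds) ≡⟨ cong sizeF eq ⟩
        sizeF (shiftF t (place Ds))            ≡⟨ sizeF-relabel _ (place Ds) ⟩
        sizeF (place Ds)                       ≡⟨ sizeF-placeFrom 0 Ds ⟩
        sizeF Ds                               ∎
        where open ≡-Reasoning

  graftLabel-place : ∀ t M Ts → All WellLabelled Ts →
                     relabelF (graftLabel t (suc (sizeF Ts)) M) (place Ts) ≡ shiftF t (place Ts)
  graftLabel-place t M Ts stds = relabelF-cong _ _ (place Ts)
    (AllLabelsF-map (λ {l} (_ , l≤n) → trans (graftLabel-< t _ M (s≤s l≤n)) (+-comm t l)) (place Ts)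
      (placeFrom-InRange 0 Ts stds))

  ≺ₜ-B⁻* : ∀ T Ts → All WellLabelled Ts → T ≺ₜ B⁻* Ts ≡ B⁺ T Ts
  ≺ₜ-B⁻* T Ts stds = ≺ₜ-B⁺ T (B⁻* Ts) Ts (graftLabel-place _ _ Ts stds)

  graftLabel-B⁺-lastChild : ∀ t g M c Hs → All WellLabelled Hs → g ≤ suc c →
    relabel (graftLabel t g M) (node (suc (suc c + sizeF Hs)) (placeFrom (suc c) Hs)) ≡ shift t (shift c (B⁻* Hs))
  graftLabel-B⁺-lastChild t g M c Hs stds g≤s = cong₂ node
    (begin
      graftLabel t g M (suc (suc c + h)) ≡⟨ graftLabel-> t g M (s≤s (≤-trans g≤s (m≤m+n (suc c) h))) ⟩
      t + (suc c + h)                    ≡⟨ +-comm t (suc c + h) ⟩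
      suc c + h + t                      ≡⟨ cong (_+ t) (trans (+-comm (suc c) h) (+-suc h c)) ⟩
      suc (h + c) + t                    ∎)
    (begin
      relabelF f (placeFrom (suc c) Hs)
        ≡⟨ relabelF-cong _ _ (placeFrom (suc c) Hs)
             (AllLabelsF-map (λ (s<l , _) → graftLabel-> t g M (≤-<-trans g≤s s<l))
                             (placeFrom (suc c) Hs) (placeFrom-InRange (suc c) Hs stds)) ⟩
      relabelF (λ l → t + (l ∸ 1)) (placeFrom (suc c) Hs)
        ≡⟨ cong (relabelF (λ l → t + (l ∸ 1))) (placeFrom≡shiftF-place (suc c) Hs) ⟩
      relabelF (λ l → t + (l ∸ 1)) (shiftF (suc c) (place Hs))
        ≡⟨ relabelF-∘ _ _ (place Hs) ⟩
      relabelF (λ l → t + (l + suc c ∸ 1)) (place Hs)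
        ≡⟨ relabelF-cong′ (λ l → trans (cong (λ z → t + (z ∸ 1)) (+-suc l c)) (+-comm t (l + c))) (place Hs) ⟩
      relabelF (λ l → l + c + t) (place Hs)
        ≡⟨ sym (relabelF-∘ _ _ (place Hs)) ⟩
      shiftF t (shiftF c (place Hs)) ∎)
    where
      open ≡-Reasoning
      h = sizeF Hs
      f = graftLabel t g M

  -- G with its root deleted, labelled as inside T ≺ₜ G for t = |T|, is a product of trees of 𝒯;
  -- by ≺ₜ-B⁺ this makes T ≺ₜ G a B⁺-tree.
  rootDeletion-𝒯 : ∀ {G} → 𝒯 G → ∀ t M →
    Σ[ Ds ∈ Forest ] All 𝒯 Ds × (relabelF (graftLabel t (root G) M) (children G) ≡ shiftF t (place Ds))
  rootDeletion-𝒯 𝒯• t M = [] , [] , refl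
  rootDeletion-𝒯 (𝒯⁻ {T} {Ts} 𝒯T 𝒯Ts) t M =
    T ∷ Ts , 𝒯T ∷ 𝒯Ts , graftLabel-place t M (T ∷ Ts) (All𝒯⇒WellLabelled (𝒯T ∷ 𝒯Ts))
  rootDeletion-𝒯 (𝒯⁺ {node g cs} {Hs} 𝒯G 𝒯Hs) t M
    with (Ds , 𝒯Ds , eqDs) ← rootDeletion-𝒯 𝒯G t M =
    Ds ++ [ B⁻* Hs ] , ++⁺ 𝒯Ds (B⁻*-𝒯 𝒯Hs ∷ []) , (begin
      relabelF f (cs ++ [ X ])
        ≡⟨ relabelF-++ f cs [ X ] ⟩
      relabelF f cs ++ [ relabel f X ]
        ≡⟨ cong₂ _++_ eqDs (cong [_] (graftLabel-B⁺-lastChild t g M c Hs (All𝒯⇒WellLabelled 𝒯Hs) g≤s)) ⟩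
      shiftF t (place Ds) ++ shiftF t (placeFrom c [ B⁻* Hs ])
        ≡⟨ sym (relabelF-++ _ (place Ds) _) ⟩
      shiftF t (place Ds ++ placeFrom c [ B⁻* Hs ])
        ≡⟨ cong (λ z → shiftF t (place Ds ++ placeFrom z [ B⁻* Hs ])) (sym |Ds|≡c) ⟩
      shiftF t (place Ds ++ placeFrom (sizeF Ds) [ B⁻* Hs ])
        ≡⟨ cong (shiftF t) (sym (placeFrom-++ 0 Ds [ B⁻* Hs ])) ⟩
      shiftF t (place (Ds ++ [ B⁻* Hs ])) ∎)
    where
      open ≡-Reasoning
      c = sizeF cs
      X = node (suc (suc c + sizeF Hs)) (placeFrom (suc c) Hs)
      f = graftLabel t g M
      g≤s : g ≤ suc c
      g≤s = proj₂ (proj₁ (𝒯⇒WellLabelled 𝒯G))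
      |Ds|≡c : sizeF Ds ≡ c
      |Ds|≡c = begin
        sizeF Ds                    ≡⟨ sym (sizeF-placeFrom 0 Ds) ⟩
        sizeF (place Ds)            ≡⟨ sym (sizeF-relabel _ (place Ds)) ⟩
        sizeF (shiftF t (place Ds)) ≡⟨ sym (cong sizeF eqDs) ⟩
        sizeF (relabelF f cs)       ≡⟨ sizeF-relabel f cs ⟩
        c                           ∎

  ≺ₜ-𝒯 : ∀ {T G} → 𝒯 T → 𝒯 G → 𝒯 (T ≺ₜ G)
  ≺ₜ-𝒯 {T} {G} 𝒯T 𝒯G with (Ds , 𝒯Ds , eqDs) ← rootDeletion-𝒯 𝒯G (size T) (size T + size G) =
    subst 𝒯 (sym (≺ₜ-B⁺ T G Ds eqDs)) (𝒯⁺ 𝒯T 𝒯Ds)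

  ≺ₜₛ-𝒯 : ∀ {T Gs} → 𝒯 T → All 𝒯 Gs → 𝒯 (T ≺ₜₛ Gs)
  ≺ₜₛ-𝒯 𝒯T [] = 𝒯T
  ≺ₜₛ-𝒯 𝒯T (𝒯G ∷ 𝒯Gs) = ≺ₜₛ-𝒯 (≺ₜ-𝒯 𝒯T 𝒯G) 𝒯Gs

  ℬ₊-· : ∀ {F G} → ℬ₊Forest F → ℬ₊Forest G → ℬ₊Forest (F · G)
  ℬ₊-· (nonempty 𝒯T 𝒯Ts) (nonempty 𝒯G 𝒯Gs) = nonempty 𝒯T (++⁺ 𝒯Ts (𝒯G ∷ 𝒯Gs))

  ℬ₊-≻ : ∀ {F G} → ℬ₊Forest F → ℬ₊Forest G → ℬ₊Forest (F ≻ G)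
  ℬ₊-≻ (nonempty 𝒯T 𝒯Ts) (nonempty 𝒯G 𝒯Gs) = nonempty (≻ₜₛ-𝒯 (𝒯T ∷ 𝒯Ts) 𝒯G) 𝒯Gs

  ≺-All𝒯 : ∀ {T Ts Gs} → 𝒯 T → All 𝒯 Ts → All 𝒯 Gs → All 𝒯 ((T ∷ Ts) ≺ Gs)
  ≺-All𝒯 𝒯T [] 𝒯Gs = ≺ₜₛ-𝒯 𝒯T 𝒯Gs ∷ []
  ≺-All𝒯 𝒯T (𝒯T′ ∷ 𝒯Ts) 𝒯Gs = 𝒯T ∷ ≺-All𝒯 𝒯T′ 𝒯Ts 𝒯Gs

  ℬ₊-≺ : ∀ {F G} → ℬ₊Forest F → ℬ₊Forest G → ℬ₊Forest (F ≺ G)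
  ℬ₊-≺ (nonempty 𝒯T []) (nonempty 𝒯G 𝒯Gs) = nonempty (≺ₜₛ-𝒯 𝒯T (𝒯G ∷ 𝒯Gs)) []
  ℬ₊-≺ (nonempty 𝒯T (𝒯T′ ∷ 𝒯Ts)) (nonempty 𝒯G 𝒯Gs) = nonempty 𝒯T (≺-All𝒯 𝒯T′ 𝒯Ts (𝒯G ∷ 𝒯Gs))

  -- does (a ℕ.≟ b) computes to a ℕ.≡ᵇ b, which is therefore the term to abstract over.
  mutual
    ==-reflects : ∀ t u → Reflects (t ≡ u) (t == u)
    ==-reflects (node a cs) (node b ds)
      with a ℕ.≡ᵇ b | fromEquivalence (≡ᵇ⇒≡ a b) (≡⇒≡ᵇ a b) | cs ==F ds | ==F-reflects cs ds
    ... | true  | ofʸ refl | true  | ofʸ refl = ofʸ refl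
    ... | true  | ofʸ refl | false | ofⁿ cs≢ds = ofⁿ λ { refl → cs≢ds refl }
    ... | false | ofⁿ a≢b  | _     | _ = ofⁿ λ { refl → a≢b refl }

    ==F-reflects : ∀ ts us → Reflects (ts ≡ us) (ts ==F us)
    ==F-reflects [] [] = ofʸ refl
    ==F-reflects [] (_ ∷ _) = ofⁿ λ ()
    ==F-reflects (_ ∷ _) [] = ofⁿ λ ()
    ==F-reflects (t ∷ ts) (u ∷ us) with t == u | ==-reflects t u | ts ==F us | ==F-reflects ts us
    ... | true  | ofʸ refl | true  | ofʸ refl = ofʸ refl
    ... | true  | ofʸ refl | false | ofⁿ ts≢us = ofⁿ λ { refl → ts≢us refl }
    ... | false | ofⁿ t≢u  | _     | _ = ofⁿ λ { refl → t≢u refl }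

  _≟F_ : DecidableEquality Forest
  F ≟F G = (F ==F G) because ==F-reflects F G

open Trees

module Span {c ℓ₁ ℓ₂} (K : HeytingField c ℓ₁ ℓ₂) where
  open import Algebra.Apartness.Bundles using (HeytingCommutativeRing)
  open import Algebra.Bundles using (CommutativeRing)
  import Algebra.Properties.CommutativeSemigroup as CommutativeSemigroupProperties
  open import Data.Bool using (Bool; true; false; if_then_else_)
  open import Data.List using (List; []; _∷_; _++_; [_]; map; concatMap; deduplicate)
  open import Data.List.Membership.Propositional using (_∈_)
  open import Data.List.Membership.Propositional.Properties using (∈-deduplicate⁺; ∈-++⁺ˡ; ∈-++⁺ʳ)
  open import Data.List.Relation.Binary.Subset.Propositional using (_⊆_)
  open import Data.List.Relation.Unary.All using (All; []; _∷_)
  import Data.List.Relation.Unary.All as All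
  open import Data.List.Relation.Unary.All.Properties using (++⁺; map⁺; concat⁺)
  open import Data.List.Relation.Unary.Any using (here; there)
  open import Data.List.Relation.Unary.Unique.DecPropositional.Properties using (deduplicate-!)
  open import Data.List.Relation.Unary.Unique.Propositional using (Unique; _∷_)
  open import Data.Product using (_×_; _,_; proj₂)
  open import Function using (_∘_)
  open import Relation.Binary.PropositionalEquality as ≡ using (_≢_; ≢-sym)
  import Relation.Binary.Reasoning.Setoid as SetoidReasoning
  open import Relation.Nullary using (contradiction)
  open import Relation.Nullary.Reflects using (ofʸ; ofⁿ)

  open Lin K
  open CommutativeRing (HeytingCommutativeRing.commutativeRing (HeytingField.heytingCommutativeRing K))
    renaming (Carrier to k; _+_ to _+ₖ_; _*_ to _*ₖ_)
  open SetoidReasoning setoid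
  open CommutativeSemigroupProperties +-commutativeSemigroup using (interchange)

  indicator : Bool → k
  indicator b = if b then 1# else 0#

  if-then-0≈*indicator : ∀ b a → (if b then a else 0#) ≈ a *ₖ indicator b
  if-then-0≈*indicator true a = sym (*-identityʳ a)
  if-then-0≈*indicator false a = sym (zeroʳ a)

  if-then-0-cong : ∀ b {a a′} → a ≈ a′ → (if b then a else 0#) ≈ (if b then a′ else 0#)
  if-then-0-cong true a≈a′ = a≈a′
  if-then-0-cong false a≈a′ = refl

  δ-≢ : ∀ {F G} a → F ≢ G → (if F ==F G then a else 0#) ≈ 0#
  δ-≢ {F} {G} a F≢G with F ==F G | ==F-reflects F G
  ... | true  | ofʸ F≡G = contradiction F≡G F≢G
  ... | false | _ = refl

  δ-≡ : ∀ F a → (if F ==F F then a else 0#) ≈ a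
  δ-≡ F a with F ==F F | ==F-reflects F F
  ... | true  | _ = refl
  ... | false | ofⁿ F≢F = contradiction ≡.refl F≢F

  coeff-++ : ∀ u v F → coeff (u ++ v) F ≈ coeff u F +ₖ coeff v F
  coeff-++ [] v F = sym (+-identityˡ _)
  coeff-++ ((a , G) ∷ u) v F = trans (+-congˡ (coeff-++ u v F)) (sym (+-assoc _ _ _))

  coeff-∙ : ∀ a u F → coeff (a ∙ᵥ u) F ≈ a *ₖ coeff u F
  coeff-∙ a [] F = sym (zeroʳ a)
  coeff-∙ a ((b , G) ∷ u) F = begin
    (if G ==F F then a *ₖ b else 0#) +ₖ coeff (a ∙ᵥ u) F
      ≈⟨ +-cong (if-then-0≈*indicator (G ==F F) (a *ₖ b)) (coeff-∙ a u F) ⟩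
    a *ₖ b *ₖ indicator (G ==F F) +ₖ a *ₖ coeff u F
      ≈⟨ +-congʳ (trans (*-assoc a b _) (*-congˡ (sym (if-then-0≈*indicator (G ==F F) b)))) ⟩
    a *ₖ (if G ==F F then b else 0#) +ₖ a *ₖ coeff u F
      ≈⟨ sym (distribˡ a _ _) ⟩
    a *ₖ coeff ((b , G) ∷ u) F ∎

  pairing : V → (Forest → k) → k
  pairing [] h = 0#
  pairing ((a , F) ∷ u) h = a *ₖ h F +ₖ pairing u h

  pairing-congʳ : ∀ u {h h′} → (∀ F → h F ≈ h′ F) → pairing u h ≈ pairing u h′
  pairing-congʳ [] h≈h′ = refl
  pairing-congʳ ((a , F) ∷ u) h≈h′ = +-cong (*-congˡ (h≈h′ F)) (pairing-congʳ u h≈h′)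

  sumOver : List Forest → (Forest → k) → k
  sumOver [] x = 0#
  sumOver (F ∷ D) x = x F +ₖ sumOver D x

  sumOver-cong : ∀ D {x y} → (∀ F → x F ≈ y F) → sumOver D x ≈ sumOver D y
  sumOver-cong [] x≈y = refl
  sumOver-cong (F ∷ D) x≈y = +-cong (x≈y F) (sumOver-cong D x≈y)

  sumOver-+ : ∀ D x y → sumOver D (λ F → x F +ₖ y F) ≈ sumOver D x +ₖ sumOver D y
  sumOver-+ [] x y = sym (+-identityˡ 0#)
  sumOver-+ (F ∷ D) x y = trans (+-congˡ (sumOver-+ D x y)) (interchange _ _ _ _)

  sumOver-zero : ∀ {D x} → All (λ F → x F ≈ 0#) D → sumOver D x ≈ 0#
  sumOver-zero [] = refl
  sumOver-zero (x≈0 ∷ xs≈0) = trans (+-cong x≈0 (sumOver-zero xs≈0)) (+-identityˡ 0#)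

  sumOver-δ : ∀ {D F₀} a → Unique D → F₀ ∈ D → sumOver D (λ F → if F₀ ==F F then a else 0#) ≈ a
  sumOver-δ {F ∷ D} a (F∉D ∷ _) (here ≡.refl) =
    trans (+-cong (δ-≡ F a) (sumOver-zero (All.map (δ-≢ a) F∉D))) (+-identityʳ a)
  sumOver-δ {F ∷ D} a (F∉D ∷ unique) (there F₀∈D) =
    trans (+-cong (δ-≢ a (≢-sym (All.lookup F∉D F₀∈D))) (sumOver-δ a unique F₀∈D)) (+-identityˡ a)

  support : V → List Forest
  support = map proj₂

  pairing≈sumOver-coeff : ∀ {D} u h → Unique D → support u ⊆ D →
                          pairing u h ≈ sumOver D (λ F → coeff u F *ₖ h F)
  pairing≈sumOver-coeff {D} [] h unique ⊆D = sym (sumOver-zero {D} (All.tabulate λ {F} _ → zeroˡ (h F)))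
  pairing≈sumOver-coeff {D} ((a , F₀) ∷ u) h unique ⊆D = begin
    a *ₖ h F₀ +ₖ pairing u h
      ≈⟨ +-cong (sym (sumOver-δ (a *ₖ h F₀) unique (⊆D (here ≡.refl))))
                (pairing≈sumOver-coeff u h unique (⊆D ∘ there)) ⟩
    sumOver D (λ F → if F₀ ==F F then a *ₖ h F₀ else 0#) +ₖ sumOver D (λ F → coeff u F *ₖ h F)
      ≈⟨ sym (sumOver-+ D _ _) ⟩
    sumOver D (λ F → (if F₀ ==F F then a *ₖ h F₀ else 0#) +ₖ coeff u F *ₖ h F)
      ≈⟨ sumOver-cong D termwise ⟩
    sumOver D (λ F → coeff ((a , F₀) ∷ u) F *ₖ h F) ∎
    where
      termwise : ∀ F → (if F₀ ==F F then a *ₖ h F₀ else 0#) +ₖ coeff u F *ₖ h F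
                       ≈ ((if F₀ ==F F then a else 0#) +ₖ coeff u F) *ₖ h F
      termwise F with F₀ ==F F | ==F-reflects F₀ F
      ... | true  | ofʸ ≡.refl = sym (distribʳ (h F) a (coeff u F))
      ... | false | _ = trans (+-congʳ (sym (zeroˡ (h F)))) (sym (distribʳ (h F) 0# (coeff u F)))

  pairing-congˡ : ∀ {u u′} h → u ≈ᵥ u′ → pairing u h ≈ pairing u′ h
  pairing-congˡ {u} {u′} h u≈u′ = begin
    pairing u h
      ≈⟨ pairing≈sumOver-coeff u h unique (∈-deduplicate⁺ _≟F_ ∘ ∈-++⁺ˡ) ⟩
    sumOver D (λ F → coeff u F *ₖ h F)
      ≈⟨ sumOver-cong D (λ F → *-congʳ (u≈u′ F)) ⟩
    sumOver D (λ F → coeff u′ F *ₖ h F)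
      ≈⟨ pairing≈sumOver-coeff u′ h unique (∈-deduplicate⁺ _≟F_ ∘ ∈-++⁺ʳ (support u)) ⟨
    pairing u′ h ∎
    where
      D = deduplicate _≟F_ (support u ++ support u′)
      unique : Unique D
      unique = deduplicate-! _≟F_ (support u ++ support u′)

  coeff-concatMap-∷ : ∀ (f : k × Forest → V) x u H →
                      coeff (concatMap f (x ∷ u)) H ≈ coeff (concatMap f [ x ]) H +ₖ coeff (concatMap f u) H
  coeff-concatMap-∷ f x u H =
    trans (coeff-++ (f x) (concatMap f u) H) (+-congʳ (trans (sym (+-identityʳ _)) (sym (coeff-++ (f x) [] H))))

  coeff-bilin-[] : ∀ op a F v H → coeff (bilin op [ (a , F) ] v) H ≈ a *ₖ pairing v (λ G → indicator (op F G ==F H))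
  coeff-bilin-[] op a F [] H = sym (zeroʳ a)
  coeff-bilin-[] op a F ((b , G) ∷ v) H = begin
    (if op F G ==F H then a *ₖ b else 0#) +ₖ coeff (bilin op [ (a , F) ] v) H
      ≈⟨ +-cong (if-then-0≈*indicator (op F G ==F H) (a *ₖ b)) (coeff-bilin-[] op a F v H) ⟩
    a *ₖ b *ₖ indicator (op F G ==F H) +ₖ a *ₖ pairing v (λ G → indicator (op F G ==F H))
      ≈⟨ +-congʳ (*-assoc a b _) ⟩
    a *ₖ (b *ₖ indicator (op F G ==F H)) +ₖ a *ₖ pairing v (λ G → indicator (op F G ==F H))
      ≈⟨ sym (distribˡ a _ _) ⟩
    a *ₖ pairing ((b , G) ∷ v) (λ G → indicator (op F G ==F H)) ∎

  coeff-bilin : ∀ op u v H →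
    coeff (bilin op u v) H ≈ pairing u (λ F → pairing v (λ G → indicator (op F G ==F H)))
  coeff-bilin op [] v H = refl
  coeff-bilin op ((a , F) ∷ u) v H =
    trans (coeff-concatMap-∷ _ (a , F) u H) (+-cong (coeff-bilin-[] op a F v H) (coeff-bilin op u v H))

  bilin-cong : ∀ op {u u′ v v′} → u ≈ᵥ u′ → v ≈ᵥ v′ → bilin op u v ≈ᵥ bilin op u′ v′
  bilin-cong op {u} {u′} {v} {v′} u≈u′ v≈v′ H = begin
    coeff (bilin op u v) H
      ≈⟨ coeff-bilin op u v H ⟩
    pairing u (λ F → pairing v (λ G → indicator (op F G ==F H)))
      ≈⟨ pairing-congˡ {u} {u′} _ u≈u′ ⟩
    pairing u′ (λ F → pairing v (λ G → indicator (op F G ==F H)))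
      ≈⟨ pairing-congʳ u′ (λ F → pairing-congˡ {v} {v′} _ v≈v′) ⟩
    pairing u′ (λ F → pairing v′ (λ G → indicator (op F G ==F H)))
      ≈⟨ coeff-bilin op u′ v′ H ⟨
    coeff (bilin op u′ v′) H ∎

  Inℬ₊-+ : ∀ {u v} → Inℬ₊ u → Inℬ₊ v → Inℬ₊ (u +ᵥ v)
  Inℬ₊-+ {u} {v} (w , u≈w , ℬw) (w′ , v≈w′ , ℬw′) =
    w ++ w′ ,
    (λ F → trans (coeff-++ u v F) (trans (+-cong (u≈w F) (v≈w′ F)) (sym (coeff-++ w w′ F)))) ,
    ++⁺ ℬw ℬw′

  Inℬ₊-∙ : ∀ {u} a → Inℬ₊ u → Inℬ₊ (a ∙ᵥ u)
  Inℬ₊-∙ {u} a (w , u≈w , ℬw) =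
    a ∙ᵥ w ,
    (λ F → trans (coeff-∙ a u F) (trans (*-congˡ (u≈w F)) (sym (coeff-∙ a w F)))) ,
    map⁺ ℬw

  Inℬ₊-≈ : ∀ {u v} → u ≈ᵥ v → Inℬ₊ u → Inℬ₊ v
  Inℬ₊-≈ u≈v (w , u≈w , ℬw) = w , (λ F → trans (sym (u≈v F)) (u≈w F)) , ℬw

  Inℬ₊-bilin : ∀ op → (∀ {F G} → ℬ₊Forest F → ℬ₊Forest G → ℬ₊Forest (op F G)) →
               ∀ {u v} → Inℬ₊ u → Inℬ₊ v → Inℬ₊ (bilin op u v)
  Inℬ₊-bilin op closed {u} {v} (w , u≈w , ℬw) (w′ , v≈w′ , ℬw′) =
    bilin op w w′ , bilin-cong op {u} {w} {v} {w′} u≈w v≈w′ ,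
    concat⁺ (map⁺ (All.map (λ ℬF → map⁺ (All.map (closed ℬF) ℬw′)) ℬw))

  Gen⇒Inℬ₊ : ∀ {v} → Gen v → Inℬ₊ v
  Gen⇒Inℬ₊ gen• = basis [ •₁ ] , (λ F → refl) , nonempty 𝒯• [] ∷ []
  Gen⇒Inℬ₊ gen0 = [] , (λ F → refl) , []
  Gen⇒Inℬ₊ (gen+ {u} {v} gu gv) = Inℬ₊-+ {u} {v} (Gen⇒Inℬ₊ gu) (Gen⇒Inℬ₊ gv)
  Gen⇒Inℬ₊ (gen∙ {u} a gu) = Inℬ₊-∙ {u} a (Gen⇒Inℬ₊ gu)
  Gen⇒Inℬ₊ (gen≈ {u} {v} u≈v gu) = Inℬ₊-≈ {u} {v} u≈v (Gen⇒Inℬ₊ gu)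
  Gen⇒Inℬ₊ (gen· {u} {v} gu gv) = Inℬ₊-bilin _·_ ℬ₊-· {u} {v} (Gen⇒Inℬ₊ gu) (Gen⇒Inℬ₊ gv)
  Gen⇒Inℬ₊ (gen≻ {u} {v} gu gv) = Inℬ₊-bilin _≻_ ℬ₊-≻ {u} {v} (Gen⇒Inℬ₊ gu) (Gen⇒Inℬ₊ gv)
  Gen⇒Inℬ₊ (gen≺ {u} {v} gu gv) = Inℬ₊-bilin _≺_ ℬ₊-≺ {u} {v} (Gen⇒Inℬ₊ gu) (Gen⇒Inℬ₊ gv)

  bilin-basis : ∀ op F G → bilin op (basis F) (basis G) ≈ᵥ basis (op F G)
  bilin-basis op F G H = +-congʳ (if-then-0-cong (op F G ==F H) (*-identityˡ 1#))

  Gen-basis : ∀ op → (∀ {u v} → Gen u → Gen v → Gen (bilin op u v)) →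
              ∀ {F G} → Gen (basis F) → Gen (basis G) → Gen (basis (op F G))
  Gen-basis op gen-op {F} {G} gF gG = gen≈ (bilin-basis op F G) (gen-op gF gG)

  mutual
    Gen-𝒯 : ∀ {T} → 𝒯 T → Gen (basis [ T ])
    Gen-𝒯 𝒯• = gen•
    Gen-𝒯 (𝒯⁻ 𝒯T 𝒯Ts) = Gen-B⁻ 𝒯T 𝒯Ts
    Gen-𝒯 (𝒯⁺ {T} {Ts} 𝒯T 𝒯Ts) =
      ≡.subst (λ R → Gen (basis [ R ])) (≺ₜ-B⁻* T Ts (All𝒯⇒WellLabelled 𝒯Ts))
      (Gen-basis _≺_ gen≺ (Gen-𝒯 𝒯T) (Gen-B⁻* 𝒯Ts))

    Gen-B⁻ : ∀ {T Ts} → 𝒯 T → All 𝒯 Ts → Gen (basis [ B⁻ T Ts ])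
    Gen-B⁻ {T} {Ts} 𝒯T 𝒯Ts = ≡.subst (λ R → Gen (basis [ R ])) (≻ₜₛ-•₁ (T ∷ Ts))
      (Gen-basis _≻_ gen≻ (Gen-forest 𝒯T 𝒯Ts) gen•)

    Gen-B⁻* : ∀ {Ts} → All 𝒯 Ts → Gen (basis [ B⁻* Ts ])
    Gen-B⁻* [] = gen•
    Gen-B⁻* (𝒯T ∷ 𝒯Ts) = Gen-B⁻ 𝒯T 𝒯Ts

    Gen-forest : ∀ {T Ts} → 𝒯 T → All 𝒯 Ts → Gen (basis (T ∷ Ts))
    Gen-forest 𝒯T [] = Gen-𝒯 𝒯T
    Gen-forest 𝒯T (𝒯T′ ∷ 𝒯Ts) = Gen-basis _·_ gen· (Gen-𝒯 𝒯T) (Gen-forest 𝒯T′ 𝒯Ts)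

  Gen-term : ∀ a {F} → ℬ₊Forest F → Gen [ (a , F) ]
  Gen-term a {F} (nonempty 𝒯T 𝒯Ts) =
    gen≈ (λ H → +-congʳ (if-then-0-cong (F ==F H) (*-identityʳ a))) (gen∙ a (Gen-forest 𝒯T 𝒯Ts))

  Gen-combination : ∀ {w} → All (ℬ₊Forest ∘ proj₂) w → Gen w
  Gen-combination [] = gen0
  Gen-combination {(a , F) ∷ w} (ℬF ∷ ℬw) = gen+ (Gen-term a ℬF) (Gen-combination ℬw)

  Inℬ₊⇒Gen : ∀ {v} → Inℬ₊ v → Gen v
  Inℬ₊⇒Gen {v} (w , v≈w , ℬw) = gen≈ {w} {v} (λ F → sym (v≈w F)) (Gen-combination ℬw)

mainTheorem19 : ∀ {c ℓ₁ ℓ₂} (K : HeytingField c ℓ₁ ℓ₂) (v : Lin.V K) →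
                  (Lin.Gen K v → Lin.Inℬ₊ K v) × (Lin.Inℬ₊ K v → Lin.Gen K v)
mainTheorem19 K v = Span.Gen⇒Inℬ₊ K , Span.Inℬ₊⇒Gen K
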